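{- For $k=1,2$, let $H_k$ be a finite graph with a leaf $\ell_k$, and let $J_k$ be a protocol of width $2$ that clears $H_k$, consists of $s_k$ time-steps, and in which $\ell_k$ is immunized only in the last time-step. Let $H$ be the graph consisting of the disjoint union of $H_1$ and $H_2$, together with a new path between $\ell_1$ and $\ell_2$ having $s_1$ new interior vertices, and a new leaf $\ell$ adjacent to $\ell_1$. Then there is a protocol of width $2$ that clears $H$ in at most $s_2+3s_1$ time-steps and in which $\ell$ is immunized only in the last time-step.
   Context: Discrete-time immunization model with $r=s=1$. For a finite graph $H$, a protocol is a finite sequence $(A_1,\dots,A_N)$ of subsets of $V(H)$ (vertices immunized at time-step $t$; $N$ is its number of time-steps); its width is $\max_i|A_i|$. At time $0$ all vertices are red. For $t\ge1$ each vertex is green, yellow or red at time $t$: if $v\in A_t$ then $v$ is green; otherwise, a vertex red or yellow at time $t-1$ is red at time $t$, and a vertex green at time $t-1$ becomes yellow at time $t$ if it has a neighbor that is red at time $t$, and stays green otherwise. The protocol clears $H$ if all vertices are green at time $N$. (Here $s_1,s_2$ are numbers of time-steps, unrelated to the latency parameter, which is $1$.) -}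

module Defs where

open import Data.Nat using (ℕ; zero; suc; _+_; _⊔_)
open import Data.Fin using (Fin; toℕ; splitAt; _≟_; _↑ʳ_)
import Data.Fin
open import Data.Fin.Subset using (Subset; ∣_∣)
open import Data.Vec using (lookup)
open import Data.Bool using (Bool; true; false; _∧_; _∨_; not; if_then_else_)
open import Data.List using (List; []; _∷_; foldl; foldr; map; allFin; _∷ʳ_)
open import Data.List.Relation.Unary.All using (All)
open import Data.Sum using (_⊎_; inj₁; inj₂)
open import Data.Unit using (⊤; tt)
open import Data.Product using (Σ; ∃; _×_; _,_)
open import Relation.Nullary.Decidable using (⌊_⌋)
open import Relation.Nullary using (¬_)
open import Relation.Binary.PropositionalEquality using (_≡_)
open import Data.Bool.ListAction using (any)
open import Data.Nat using () renaming (_≟_ to _≟ℕ_)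

record Graph : Set where
  constructor mkGraph
  field
    n   : ℕ
    adj : Fin n → Fin n → Bool
open Graph public

IsSimple : Graph → Set
IsSimple G = (∀ u v → adj G u v ≡ adj G v u) × (∀ v → adj G v v ≡ false)

IsLeaf : (G : Graph) → Fin (n G) → Set
IsLeaf G ℓ = Σ (Fin (n G)) λ u → (adj G ℓ u ≡ true) × (∀ w → adj G ℓ w ≡ true → w ≡ u)

-- protocol: list of immunized sets (A₁ , … , A_N); N = length
Protocol : ℕ → Set
Protocol m = List (Subset m)

width : ∀ {m} → Protocol m → ℕ
width J = foldr (λ A w → ∣ A ∣ ⊔ w) 0 J

data Color : Set where
  green yellow red : Color

notGreen : Color → Bool
notGreen green  = false
notGreen yellow = true
notGreen red    = true

-- one time-step of the dynamics with r = s = 1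
step : (G : Graph) → (Fin (n G) → Color) → Subset (n G) → Fin (n G) → Color
step G prev A v =
  if lookup A v then green
  else (if notGreen (prev v) then red
        else (if any (λ u → adj G v u ∧ redNow u) (allFin (n G)) then yellow else green))
  where
  redNow : Fin (n G) → Bool
  redNow u = not (lookup A u) ∧ notGreen (prev u)

run : (G : Graph) → Protocol (n G) → Fin (n G) → Color
run G J = foldl (step G) (λ _ → red) J

Clears : (G : Graph) → Protocol (n G) → Set
Clears G J = ∀ v → run G J v ≡ green

ImmunizedOnlyLast : ∀ {m} → Protocol m → Fin m → Set
ImmunizedOnlyLast J ℓ =
  Σ _ λ P → Σ _ λ A → (J ≡ P ∷ʳ A) × (lookup A ℓ ≡ true) × All (λ B → lookup B ℓ ≡ false) P

data Vtx (n₁ n₂ s : ℕ) : Set where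
  old₁ : Fin n₁ → Vtx n₁ n₂ s
  old₂ : Fin n₂ → Vtx n₁ n₂ s
  path : Fin s  → Vtx n₁ n₂ s
  leaf : Vtx n₁ n₂ s

-- vertex set Fin (n₁ + (n₂ + (s + 1))): first H₁, then H₂, then the s path
-- vertices p₀ … p_{s-1} (ℓ₁ – p₀ – … – p_{s-1} – ℓ₂), finally the new leaf ℓ
classify : ∀ {n₁ n₂ s} → Fin (n₁ + (n₂ + (s + 1))) → Vtx n₁ n₂ s
classify {n₁} {n₂} {s} x with splitAt n₁ x
... | inj₁ a = old₁ a
... | inj₂ y with splitAt n₂ y
...   | inj₁ b = old₂ b
...   | inj₂ z with splitAt s z
...     | inj₁ i = path i
...     | inj₂ _ = leaf

eqF : ∀ {m} → Fin m → Fin m → Bool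
eqF a b = ⌊ a ≟ b ⌋

eqN : ℕ → ℕ → Bool
eqN a b = ⌊ a ≟ℕ b ⌋

vadj : (G₁ G₂ : Graph) → Fin (n G₁) → Fin (n G₂) → (s : ℕ) →
       Vtx (n G₁) (n G₂) s → Vtx (n G₁) (n G₂) s → Bool
vadj G₁ G₂ ℓ₁ ℓ₂ s (old₁ a) (old₁ b) = adj G₁ a b
vadj G₁ G₂ ℓ₁ ℓ₂ s (old₂ a) (old₂ b) = adj G₂ a b
vadj G₁ G₂ ℓ₁ ℓ₂ s (old₁ a) (old₂ b) = eqN s 0 ∧ eqF a ℓ₁ ∧ eqF b ℓ₂
vadj G₁ G₂ ℓ₁ ℓ₂ s (old₂ b) (old₁ a) = eqN s 0 ∧ eqF a ℓ₁ ∧ eqF b ℓ₂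
vadj G₁ G₂ ℓ₁ ℓ₂ s (old₁ a) (path i) = eqF a ℓ₁ ∧ eqN (toℕ i) 0
vadj G₁ G₂ ℓ₁ ℓ₂ s (path i) (old₁ a) = eqF a ℓ₁ ∧ eqN (toℕ i) 0
vadj G₁ G₂ ℓ₁ ℓ₂ s (old₂ b) (path i) = eqF b ℓ₂ ∧ eqN (suc (toℕ i)) s
vadj G₁ G₂ ℓ₁ ℓ₂ s (path i) (old₂ b) = eqF b ℓ₂ ∧ eqN (suc (toℕ i)) s
vadj G₁ G₂ ℓ₁ ℓ₂ s (path i) (path j) = eqN (suc (toℕ i)) (toℕ j) ∨ eqN (suc (toℕ j)) (toℕ i)
vadj G₁ G₂ ℓ₁ ℓ₂ s (old₁ a) leaf = eqF a ℓ₁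
vadj G₁ G₂ ℓ₁ ℓ₂ s leaf (old₁ a) = eqF a ℓ₁
vadj G₁ G₂ ℓ₁ ℓ₂ s _ _ = false

glue : (G₁ G₂ : Graph) → Fin (n G₁) → Fin (n G₂) → ℕ → Graph
glue G₁ G₂ ℓ₁ ℓ₂ s =
  mkGraph (n G₁ + (n G₂ + (s + 1)))
          (λ x y → vadj G₁ G₂ ℓ₁ ℓ₂ s (classify x) (classify y))

newLeaf : (G₁ G₂ : Graph) → (s : ℕ) → Fin (n G₁ + (n G₂ + (s + 1)))
newLeaf G₁ G₂ s = n G₁ ↑ʳ (n G₂ ↑ʳ (s ↑ʳ Data.Fin.zero {0}))

module Submission where

open import Defs
open import Data.Bool using (Bool; true; false; _∧_; _∨_; not; T; if_then_else_)
import Data.Bool as Bool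
open import Data.Bool.Properties using (¬-not; T-∧; T-≡; ∧-zeroʳ; ∧-conicalˡ; ∧-conicalʳ)
open import Data.Bool.ListAction using (any)
open import Data.Empty using (⊥-elim)
open import Data.Fin using (Fin; zero; suc; toℕ; _≟_; splitAt; _↑ˡ_; _↑ʳ_)
open import Data.Fin.Properties using (toℕ<n; splitAt-↑ˡ; splitAt-↑ʳ; splitAt⁻¹-↑ˡ; splitAt⁻¹-↑ʳ)
open import Data.Fin.Subset using (Subset; ∣_∣; ⊥; ⁅_⁆)
open import Data.Fin.Subset.Properties using (∣⊥∣≡0; ∣⁅x⁆∣≡1; x∈⁅x⁆)
open import Data.List using ([]; _∷_; [_]; foldl; map; allFin; _++_; _∷ʳ_; length; applyDownFrom)
open import Data.List.Properties using (foldl-++; foldl-∷ʳ; map-++; length-map; length-++; length-applyDownFrom)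
open import Data.List.Membership.Propositional using (lose)
open import Data.List.Membership.Propositional.Properties using (∈-allFin; ∈-insert)
open import Data.List.Relation.Unary.All using (All; []; _∷_)
import Data.List.Relation.Unary.All as All
open import Data.List.Relation.Unary.All.Properties using (map⁺; ++⁺; ∷ʳ⁺; applyDownFrom⁺₂)
open import Data.List.Relation.Unary.Any using (satisfied)
open import Data.List.Relation.Unary.Any.Properties using (any⁺; any⁻)
import Data.Nat as ℕ
open import Data.Nat using (ℕ; zero; suc; _+_; _*_; _≤_; _<_; z≤n; s≤s; s≤s⁻¹)
open import Data.Nat.Properties
  using (≤-refl; ≤-reflexive; ≤-trans; ≤-antisym; <⇒≤; ≤⇒≯; n≤1+n; m<n⇒m<1+n; m≤n⇒m<n∨m≡n; n≤0⇒n≡0;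
         suc-injective; +-suc; +-identityʳ; m≤m⊔n; m≤n⊔m; ⊔-lub)
open import Data.Nat.Tactic.RingSolver using (solve-∀)
open import Data.Product using (Σ; ∃; _×_; _,_; proj₁; proj₂)
open import Data.Sum using (_⊎_; inj₁; inj₂)
open import Data.Vec using (lookup; []; _∷_) renaming (_++_ to _++ᵥ_)
open import Data.Vec.Properties using (lookup-++ˡ; lookup-++ʳ; lookup-replicate; []=⇒lookup)
open import Function using (_∘_; _⇔_; mk⇔; Equivalence)
open import Relation.Nullary using (Dec; yes; no; contradiction)
open import Relation.Nullary.Decidable using (isYes)
open import Relation.Binary.PropositionalEquality
  using (_≡_; _≢_; refl; sym; trans; cong; cong₂; subst; module ≡-Reasoning)

-- Write s = |J₁| and p₀ … p_{s-1} for the path from ℓ₁ to ℓ₂. First run J₂ on H₂, then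
-- immunize p_{s-1}, …, p₁ one per step (s - 1 steps). While J₁ now clears H₁ in s steps,
-- the infection entering the path at p₀ advances at most one vertex per step, so it can
-- reach ℓ₂ but no other vertex of H₂. Immunize ℓ₂ together with p_{s-1}, then p_{s-2}, …, p₀,
-- each together with ℓ₁ (s - 1 steps), and finally ℓ₁ together with ℓ. This takes
-- s₂ + (s - 1) + s + 1 + (s - 1) + 1 = s₂ + 3s steps of width at most 2. The argument
-- never uses that H₁, H₂ are simple or that ℓ₁, ℓ₂ are leaves.

State : Graph → Set
State G = Fin (n G) → Color

Infected : ∀ {m} → (Fin m → Color) → Fin m → Set
Infected S v = notGreen (S v) ≡ true

Harmless : ∀ {m} → (Fin m → Color) → Subset m → Fin m → Set
Harmless S A u = lookup A u ≡ true ⊎ S u ≡ green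

redNow : ∀ {m} → (Fin m → Color) → Subset m → Fin m → Bool
redNow S A u = not (lookup A u) ∧ notGreen (S u)

hasRedNeighbour : (G : Graph) → State G → Subset (n G) → Fin (n G) → Bool
hasRedNeighbour G S A v = any (λ u → adj G v u ∧ redNow S A u) (allFin (n G))

notGreen-cases : ∀ a b c →
  notGreen (if a then green else if b then red else if c then yellow else green) ≡ not a ∧ (b ∨ c)
notGreen-cases true  b     c     = refl
notGreen-cases false true  c     = refl
notGreen-cases false false true  = refl
notGreen-cases false false false = refl

notGreen-step : ∀ G S A v →
  notGreen (step G S A v) ≡ not (lookup A v) ∧ (notGreen (S v) ∨ hasRedNeighbour G S A v)
notGreen-step G S A v = notGreen-cases (lookup A v) (notGreen (S v)) (hasRedNeighbour G S A v)

notGreen⇒green : ∀ {c} → notGreen c ≡ false → c ≡ green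
notGreen⇒green {green} _ = refl

T-injective : ∀ {a b} → (T a → T b) → (T b → T a) → a ≡ b
T-injective {false} {false} _ _ = refl
T-injective {false} {true}  _ f = ⊥-elim (f _)
T-injective {true}  {false} f _ = ⊥-elim (f _)
T-injective {true}  {true}  _ _ = refl

hasRedNeighbour⇔ : ∀ G S A v → T (hasRedNeighbour G S A v) ⇔ ∃ λ u → T (adj G v u ∧ redNow S A u)
hasRedNeighbour⇔ G S A v =
  mk⇔ (λ t → satisfied (any⁻ _ (allFin (n G)) t)) (λ (u , t) → any⁺ _ (lose (∈-allFin u) t))

step-immunized : ∀ G S A v → lookup A v ≡ true → step G S A v ≡ green
step-immunized G S A v immunized rewrite immunized = refl

step-keeps-infected : ∀ G S A v → Infected S v → lookup A v ≡ false → Infected (step G S A) v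
step-keeps-infected G S A v infected notImmunized rewrite notImmunized | infected = refl

redNow-harmless : ∀ {m} (S : Fin m → Color) A u → Harmless S A u → redNow S A u ≡ false
redNow-harmless S A u (inj₁ immunized) rewrite immunized = refl
redNow-harmless S A u (inj₂ isGreen)   rewrite isGreen   = ∧-zeroʳ (not (lookup A u))

hasRedNeighbour-harmless : ∀ G S A v → (∀ u → adj G v u ≡ true → Harmless S A u) →
  hasRedNeighbour G S A v ≡ false
hasRedNeighbour-harmless G S A v harmless =
  T-injective (λ t → noRed (Equivalence.to (hasRedNeighbour⇔ G S A v) t)) λ ()
  where
  noRed : (∃ λ u → T (adj G v u ∧ redNow S A u)) → T false
  noRed (u , t) with Equivalence.to T-∧ t
  ... | isAdj , isRed = subst T (redNow-harmless S A u (harmless u (Equivalence.to T-≡ isAdj))) isRed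

step-keeps-green : ∀ G S A v → S v ≡ green → (∀ u → adj G v u ≡ true → Harmless S A u) →
  step G S A v ≡ green
step-keeps-green G S A v isGreen harmless = notGreen⇒green (begin
  notGreen (step G S A v)                                        ≡⟨ notGreen-step G S A v ⟩
  not (lookup A v) ∧ (notGreen (S v) ∨ hasRedNeighbour G S A v)  ≡⟨ cong₂ (λ b c → not (lookup A v) ∧ (notGreen b ∨ c))
                                                                      isGreen (hasRedNeighbour-harmless G S A v harmless) ⟩
  not (lookup A v) ∧ false                                       ≡⟨ ∧-zeroʳ _ ⟩
  false                                                          ∎)
  where open ≡-Reasoning

run-keeps-infected : ∀ G S (J : Protocol (n G)) v → Infected S v → All (λ A → lookup A v ≡ false) J →
  Infected (foldl (step G) S J) v
run-keeps-infected G S []      v infected []            = infected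
run-keeps-infected G S (A ∷ J) v infected (notA ∷ notJ) =
  run-keeps-infected G (step G S A) J v (step-keeps-infected G S A v infected notA) notJ

GreenBeyond : (G : Graph) → (Fin (n G) → ℕ) → ℕ → State G → Set
GreenBeyond G β d S = ∀ u → d < β u → S u ≡ green

-- If β changes by at most one along an edge, infection travels at most one unit of β per step.
module _ (G : Graph) (β : Fin (n G) → ℕ) (β-adj : ∀ u w → adj G u w ≡ true → β u ≤ suc (β w)) where

  step-greenBeyond : ∀ d S A → GreenBeyond G β d S → GreenBeyond G β (suc d) (step G S A)
  step-greenBeyond d S A far u d+1<βu = step-keeps-green G S A u (far u (≤-trans (n≤1+n _) d+1<βu)) harmless
    where
    harmless : ∀ w → adj G u w ≡ true → Harmless S A w
    harmless w uw = inj₂ (far w (s≤s⁻¹ (≤-trans d+1<βu (β-adj u w uw))))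

  run-greenBeyond : ∀ d S (J : Protocol (n G)) →
    GreenBeyond G β d S → GreenBeyond G β (d + length J) (foldl (step G) S J)
  run-greenBeyond d S []      far rewrite +-identityʳ d = far
  run-greenBeyond d S (A ∷ J) far rewrite +-suc d (length J) =
    run-greenBeyond (suc d) (step G S A) J (step-greenBeyond d S A far)

Triple : (G : Graph) → (State G → Set) → Protocol (n G) → (State G → Set) → Set
Triple G P J Q = ∀ S → P S → Q (foldl (step G) S J)

triple-++ : ∀ G {P Q R} J K → Triple G P J Q → Triple G Q K R → Triple G P (J ++ K) R
triple-++ G {R = R} J K first second S p = subst R (sym (foldl-++ (step G) S J K)) (second _ (first S p))

triple-applyDownFrom : ∀ G (I : ℕ → State G → Set) (f : ℕ → Subset (n G)) →
  (∀ k → Triple G (I (suc k)) [ f k ] (I k)) → ∀ m → Triple G (I m) (applyDownFrom f m) (I 0)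
triple-applyDownFrom G I f next zero    S p = p
triple-applyDownFrom G I f next (suc m) S p = triple-applyDownFrom G I f next m _ (next m S p)

-- ℓ may have further neighbours in H, but while it is infected and not immunized it is red
-- whatever they are, so the image of a protocol that immunizes ℓ only last runs on H as on G.
module Embedding {G H : Graph} (e : Fin (n G) → Fin (n H)) (emb : Subset (n G) → Subset (n H)) (ℓ : Fin (n G))
  (lookup-emb : ∀ B v → lookup (emb B) (e v) ≡ lookup B v)
  (adj-e : ∀ v w → adj H (e v) (e w) ≡ adj G v w)
  (adj-e⁻ : ∀ v → v ≢ ℓ → ∀ y → adj H (e v) y ≡ true → ∃ λ w → y ≡ e w) where

  Agree : State H → State G → Set
  Agree S S′ = ∀ v → notGreen (S (e v)) ≡ notGreen (S′ v)

  hasRedNeighbour-agree : ∀ {S S′} B v → Agree S S′ → v ≢ ℓ →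
    hasRedNeighbour H S (emb B) (e v) ≡ hasRedNeighbour G S′ B v
  hasRedNeighbour-agree {S} {S′} B v agree v≢ℓ =
    T-injective (λ t → Equivalence.from inG (toG (Equivalence.to inH t)))
                (λ t → Equivalence.from inH (toH (Equivalence.to inG t)))
    where
    inH = hasRedNeighbour⇔ H S (emb B) (e v)
    inG = hasRedNeighbour⇔ G S′ B v
    redH : Fin (n H) → Bool
    redH y = adj H (e v) y ∧ redNow S (emb B) y
    redG : Fin (n G) → Bool
    redG w = adj G v w ∧ redNow S′ B w
    redH-e : ∀ w → redH (e w) ≡ redG w
    redH-e w = cong₂ _∧_ (adj-e v w) (cong₂ (λ a b → not a ∧ b) (lookup-emb B w) (agree w))
    toH : (∃ λ w → T (redG w)) → ∃ λ y → T (redH y)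
    toH (w , t) = e w , subst T (sym (redH-e w)) t
    toG : (∃ λ y → T (redH y)) → ∃ λ w → T (redG w)
    toG (y , t) with adj-e⁻ v v≢ℓ y (Equivalence.to T-≡ (proj₁ (Equivalence.to T-∧ t)))
    ... | w , refl = w , subst T (redH-e w) t

  agree-step : ∀ S S′ B → Agree S S′ → (lookup B ℓ ≡ false → Infected S′ ℓ) →
    Agree (step H S (emb B)) (step G S′ B)
  agree-step S S′ B agree ℓ-infected v with v ≟ ℓ
  ... | no v≢ℓ = begin
    notGreen (step H S (emb B) (e v))
      ≡⟨ notGreen-step H S (emb B) (e v) ⟩
    not (lookup (emb B) (e v)) ∧ (notGreen (S (e v)) ∨ hasRedNeighbour H S (emb B) (e v))
      ≡⟨ cong₂ (λ a b → not a ∧ b) (lookup-emb B v) (cong₂ _∨_ (agree v) (hasRedNeighbour-agree B v agree v≢ℓ)) ⟩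
    not (lookup B v) ∧ (notGreen (S′ v) ∨ hasRedNeighbour G S′ B v)
      ≡⟨ notGreen-step G S′ B v ⟨
    notGreen (step G S′ B v)
      ∎
    where open ≡-Reasoning
  ... | yes refl with lookup B ℓ Bool.≟ true
  ...   | yes immunized = cong notGreen (trans (step-immunized H S (emb B) (e ℓ) (trans (lookup-emb B ℓ) immunized))
                                               (sym (step-immunized G S′ B ℓ immunized)))
  ...   | no ≢true =
    trans (step-keeps-infected H S (emb B) (e ℓ) (trans (agree ℓ) infected) (trans (lookup-emb B ℓ) notImmunized))
          (sym (step-keeps-infected G S′ B ℓ infected notImmunized))
    where
    notImmunized : lookup B ℓ ≡ false
    notImmunized = ¬-not ≢true
    infected : Infected S′ ℓ
    infected = ℓ-infected notImmunized

  agree-run : ∀ S S′ P → Agree S S′ → Infected S′ ℓ → All (λ B → lookup B ℓ ≡ false) P →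
    Agree (foldl (step H) S (map emb P)) (foldl (step G) S′ P)
  agree-run S S′ []      agree infected []            = agree
  agree-run S S′ (B ∷ P) agree infected (notB ∷ notP) =
    agree-run (step H S (emb B)) (step G S′ B) P (agree-step S S′ B agree (λ _ → infected))
      (step-keeps-infected G S′ B ℓ infected notB) notP

  run-embedded-clears : ∀ S J → (∀ v → Infected S (e v)) → Clears G J → ImmunizedOnlyLast J ℓ →
    ∀ v → foldl (step H) S (map emb J) (e v) ≡ green
  run-embedded-clears S J infected clears (P , A , refl , immunizedA , notP) v = notGreen⇒green (begin
    notGreen (foldl (step H) S (map emb (P ∷ʳ A)) (e v))
      ≡⟨ cong (λ J → notGreen (foldl (step H) S J (e v))) (map-++ emb P [ A ]) ⟩
    notGreen (foldl (step H) S (map emb P ∷ʳ emb A) (e v))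
      ≡⟨ cong (λ S → notGreen (S (e v))) (foldl-∷ʳ (step H) S (emb A) (map emb P)) ⟩
    notGreen (step H Sᴴ (emb A) (e v))
      ≡⟨ agree-step Sᴴ Sᴳ A (agree-run S (λ _ → red) P infected refl notP)
                    (λ notA → contradiction (trans (sym immunizedA) notA) λ ()) v ⟩
    notGreen (step G Sᴳ A v)
      ≡⟨ cong (λ S → notGreen (S v)) (foldl-∷ʳ (step G) (λ _ → red) A P) ⟨
    notGreen (run G (P ∷ʳ A) v)
      ≡⟨ cong notGreen (clears v) ⟩
    false
      ∎)
    where
    open ≡-Reasoning
    Sᴴ = foldl (step H) S (map emb P)
    Sᴳ = foldl (step G) (λ _ → red) P

width-bounds : ∀ {m} (J : Protocol m) → All (λ A → ∣ A ∣ ≤ width J) J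
width-bounds []      = []
width-bounds (A ∷ J) = m≤m⊔n ∣ A ∣ (width J) ∷ All.map (λ bound → ≤-trans bound (m≤n⊔m ∣ A ∣ (width J))) (width-bounds J)

width-least : ∀ {m k} (J : Protocol m) → All (λ A → ∣ A ∣ ≤ k) J → width J ≤ k
width-least []      []             = z≤n
width-least (A ∷ J) (bound ∷ rest) = ⊔-lub bound (width-least J rest)

∣p++q∣ : ∀ {m k} (p : Subset m) (q : Subset k) → ∣ p ++ᵥ q ∣ ≡ ∣ p ∣ + ∣ q ∣
∣p++q∣ []          q = refl
∣p++q∣ (true ∷ p)  q = cong suc (∣p++q∣ p q)
∣p++q∣ (false ∷ p) q = ∣p++q∣ p q

lookup-⁅x⁆ : ∀ {m} (x : Fin m) → lookup ⁅ x ⁆ x ≡ true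
lookup-⁅x⁆ x = []=⇒lookup (x∈⁅x⁆ x)

lookup-⊥ : ∀ {m} (x : Fin m) → lookup ⊥ x ≡ false
lookup-⊥ x = lookup-replicate x false

-- Empty when k ≥ m.
atIndex : ∀ {m} → ℕ → Subset m
atIndex {zero}  _       = []
atIndex {suc m} zero    = true ∷ ⊥
atIndex {suc m} (suc k) = false ∷ atIndex k

lookup-atIndex : ∀ {m} (i : Fin m) → lookup (atIndex (toℕ i)) i ≡ true
lookup-atIndex zero    = refl
lookup-atIndex (suc i) = lookup-atIndex i

∣atIndex∣≤1 : ∀ {m} k → ∣ atIndex {m} k ∣ ≤ 1
∣atIndex∣≤1 {zero}  _       = z≤n
∣atIndex∣≤1 {suc m} zero    = ≤-reflexive (cong suc (∣⊥∣≡0 m))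
∣atIndex∣≤1 {suc m} (suc k) = ∣atIndex∣≤1 {m} k

isYes⇒ : ∀ {P : Set} (d : Dec P) → isYes d ≡ true → P
isYes⇒ (yes p) _ = p

eqF⇒≡ : ∀ {m} {a b : Fin m} → eqF a b ≡ true → a ≡ b
eqF⇒≡ {a = a} {b} = isYes⇒ (a ≟ b)

eqN⇒≡ : ∀ {a b} → eqN a b ≡ true → a ≡ b
eqN⇒≡ {a} {b} = isYes⇒ (a ℕ.≟ b)

module _ {n₁ n₂ s : ℕ} where

  ι : Vtx n₁ n₂ s → Fin (n₁ + (n₂ + (s + 1)))
  ι (old₁ a) = a ↑ˡ (n₂ + (s + 1))
  ι (old₂ b) = n₁ ↑ʳ (b ↑ˡ (s + 1))
  ι (path i) = n₁ ↑ʳ (n₂ ↑ʳ (i ↑ˡ 1))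
  ι leaf     = n₁ ↑ʳ (n₂ ↑ʳ (s ↑ʳ zero))

  classify-ι : ∀ v → classify (ι v) ≡ v
  classify-ι (old₁ a) rewrite splitAt-↑ˡ n₁ a (n₂ + (s + 1)) = refl
  classify-ι (old₂ b) rewrite splitAt-↑ʳ n₁ (n₂ + (s + 1)) (b ↑ˡ (s + 1)) | splitAt-↑ˡ n₂ b (s + 1) = refl
  classify-ι (path i) rewrite splitAt-↑ʳ n₁ (n₂ + (s + 1)) (n₂ ↑ʳ (i ↑ˡ 1)) | splitAt-↑ʳ n₂ (s + 1) (i ↑ˡ 1)
                            | splitAt-↑ˡ s i 1 = refl
  classify-ι leaf rewrite splitAt-↑ʳ n₁ (n₂ + (s + 1)) (n₂ ↑ʳ (s ↑ʳ zero {0})) | splitAt-↑ʳ n₂ (s + 1) (s ↑ʳ zero {0})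
                        | splitAt-↑ʳ s 1 (zero {0}) = refl

  ι-classify : ∀ x → ι (classify x) ≡ x
  ι-classify x with splitAt n₁ x in e₁
  ... | inj₁ a = splitAt⁻¹-↑ˡ e₁
  ... | inj₂ y with splitAt n₂ y in e₂
  ...   | inj₁ b = trans (cong (n₁ ↑ʳ_) (splitAt⁻¹-↑ˡ e₂)) (splitAt⁻¹-↑ʳ e₁)
  ...   | inj₂ z with splitAt s z in e₃
  ...     | inj₁ i    =
    trans (cong (n₁ ↑ʳ_) (trans (cong (n₂ ↑ʳ_) (splitAt⁻¹-↑ˡ e₃)) (splitAt⁻¹-↑ʳ e₂))) (splitAt⁻¹-↑ʳ e₁)
  ...     | inj₂ zero =
    trans (cong (n₁ ↑ʳ_) (trans (cong (n₂ ↑ʳ_) (splitAt⁻¹-↑ʳ e₃)) (splitAt⁻¹-↑ʳ e₂))) (splitAt⁻¹-↑ʳ e₁)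

  glueSubset : Subset n₁ → Subset n₂ → Subset s → Bool → Subset (n₁ + (n₂ + (s + 1)))
  glueSubset B₁ B₂ B₃ b = B₁ ++ᵥ (B₂ ++ᵥ (B₃ ++ᵥ (b ∷ [])))

  lookupᵥ : Subset n₁ → Subset n₂ → Subset s → Bool → Vtx n₁ n₂ s → Bool
  lookupᵥ B₁ B₂ B₃ b (old₁ a) = lookup B₁ a
  lookupᵥ B₁ B₂ B₃ b (old₂ c) = lookup B₂ c
  lookupᵥ B₁ B₂ B₃ b (path i) = lookup B₃ i
  lookupᵥ B₁ B₂ B₃ b leaf     = b

  lookup-glueSubset : ∀ B₁ B₂ B₃ b v → lookup (glueSubset B₁ B₂ B₃ b) (ι v) ≡ lookupᵥ B₁ B₂ B₃ b v
  lookup-glueSubset B₁ B₂ B₃ b (old₁ a) = lookup-++ˡ B₁ _ a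
  lookup-glueSubset B₁ B₂ B₃ b (old₂ c) = trans (lookup-++ʳ B₁ _ _) (lookup-++ˡ B₂ _ c)
  lookup-glueSubset B₁ B₂ B₃ b (path i) = trans (lookup-++ʳ B₁ _ _) (trans (lookup-++ʳ B₂ _ _) (lookup-++ˡ B₃ _ i))
  lookup-glueSubset B₁ B₂ B₃ b leaf     =
    trans (lookup-++ʳ B₁ _ _) (trans (lookup-++ʳ B₂ _ _) (lookup-++ʳ B₃ (b ∷ []) zero))

  ∣glueSubset∣ : ∀ B₁ B₂ B₃ b → ∣ glueSubset B₁ B₂ B₃ b ∣ ≡ ∣ B₁ ∣ + (∣ B₂ ∣ + (∣ B₃ ∣ + ∣ b ∷ [] ∣))
  ∣glueSubset∣ B₁ B₂ B₃ b = begin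
    ∣ B₁ ++ᵥ (B₂ ++ᵥ (B₃ ++ᵥ (b ∷ []))) ∣      ≡⟨ ∣p++q∣ B₁ _ ⟩
    ∣ B₁ ∣ + ∣ B₂ ++ᵥ (B₃ ++ᵥ (b ∷ [])) ∣      ≡⟨ cong (∣ B₁ ∣ +_) (∣p++q∣ B₂ _) ⟩
    ∣ B₁ ∣ + (∣ B₂ ∣ + ∣ B₃ ++ᵥ (b ∷ []) ∣)    ≡⟨ cong (λ k → ∣ B₁ ∣ + (∣ B₂ ∣ + k)) (∣p++q∣ B₃ _) ⟩
    ∣ B₁ ∣ + (∣ B₂ ∣ + (∣ B₃ ∣ + ∣ b ∷ [] ∣))  ∎
    where open ≡-Reasoning

module Glued (H₁ H₂ : Graph) (ℓ₁ : Fin (n H₁)) (ℓ₂ : Fin (n H₂)) (s′ : ℕ) where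

  s : ℕ
  s = suc s′

  H : Graph
  H = glue H₁ H₂ ℓ₁ ℓ₂ s

  V : Set
  V = Vtx (n H₁) (n H₂) s

  va : V → V → Bool
  va = vadj H₁ H₂ ℓ₁ ℓ₂ s

  ι₁ : Fin (n H₁) → Fin (n H)
  ι₁ a = ι {n H₁} {n H₂} {s} (old₁ a)

  ι₂ : Fin (n H₂) → Fin (n H)
  ι₂ b = ι {n H₁} {n H₂} {s} (old₂ b)

  ι-classifyᴴ : ∀ (x : Fin (n H)) → ι (classify {n H₁} {n H₂} {s} x) ≡ x
  ι-classifyᴴ = ι-classify {n H₁} {n H₂} {s}

  GreenAt : State H → V → Set
  GreenAt S v = S (ι v) ≡ green

  HarmlessAt : State H → Subset (n H) → V → Set
  HarmlessAt S A v = Harmless S A (ι v)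

  ImmunizedAt : Subset (n H) → V → Set
  ImmunizedAt A v = lookup A (ι v) ≡ true

  NotImmunizedAt : Subset (n H) → V → Set
  NotImmunizedAt A v = lookup A (ι v) ≡ false

  adj-ι : ∀ v w → adj H (ι v) (ι w) ≡ va v w
  adj-ι v w rewrite classify-ι v | classify-ι w = refl

  adj-ι⁻ : ∀ v y → adj H (ι v) y ≡ true → va v (classify y) ≡ true
  adj-ι⁻ v y = subst (λ u → va u (classify y) ≡ true) (classify-ι v)

  stays-green : ∀ S A v → GreenAt S v → (∀ w → va v w ≡ true → HarmlessAt S A w) → GreenAt (step H S A) v
  stays-green S A v isGreen harmless = step-keeps-green H S A (ι v) isGreen λ y vy →
    subst (Harmless S A) (ι-classifyᴴ y) (harmless (classify y) (adj-ι⁻ v y vy))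

  immunized-green : ∀ S A v → ImmunizedAt A v → GreenAt (step H S A) v
  immunized-green S A v = step-immunized H S A (ι v)

  neighbour₁ : ∀ a w → a ≢ ℓ₁ → va (old₁ a) w ≡ true → ∃ λ c → w ≡ old₁ c
  neighbour₁ a (old₁ c) _    _  = c , refl
  neighbour₁ a (old₂ _) _    ()
  neighbour₁ a (path _) a≢ℓ₁ aw = contradiction (eqF⇒≡ (∧-conicalˡ _ _ aw)) a≢ℓ₁
  neighbour₁ a leaf     a≢ℓ₁ aw = contradiction (eqF⇒≡ aw) a≢ℓ₁

  neighbour₂ : ∀ b w → b ≢ ℓ₂ → va (old₂ b) w ≡ true → ∃ λ c → w ≡ old₂ c
  neighbour₂ b (old₁ _) _    ()
  neighbour₂ b (old₂ c) _    _  = c , refl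
  neighbour₂ b (path _) b≢ℓ₂ bw = contradiction (eqF⇒≡ (∧-conicalˡ _ _ bw)) b≢ℓ₂
  neighbour₂ b leaf     _    ()

  path-adj⇒≤ : ∀ i j → va (path i) (path j) ≡ true → toℕ i ≤ suc (toℕ j)
  path-adj⇒≤ i j ij with eqN (suc (toℕ i)) (toℕ j) in i+1≡j
  ... | true  = ≤-trans (n≤1+n _) (≤-trans (≤-reflexive (eqN⇒≡ i+1≡j)) (n≤1+n _))
  ... | false = ≤-reflexive (sym (eqN⇒≡ ij))

  Interior₁Green : State H → Set
  Interior₁Green S = ∀ a → a ≢ ℓ₁ → GreenAt S (old₁ a)

  Interior₂Green : State H → Set
  Interior₂Green S = ∀ b → b ≢ ℓ₂ → GreenAt S (old₂ b)

  interior₁-step : ∀ S A → Interior₁Green S → HarmlessAt S A (old₁ ℓ₁) → Interior₁Green (step H S A)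
  interior₁-step S A interior ℓ₁-harmless a a≢ℓ₁ = stays-green S A (old₁ a) (interior a a≢ℓ₁) harmless
    where
    harmless : ∀ w → va (old₁ a) w ≡ true → HarmlessAt S A w
    harmless w aw with neighbour₁ a w a≢ℓ₁ aw
    ... | c , refl with c ≟ ℓ₁
    ...   | yes refl = ℓ₁-harmless
    ...   | no c≢ℓ₁  = inj₂ (interior c c≢ℓ₁)

  interior₂-step : ∀ S A → Interior₂Green S → HarmlessAt S A (old₂ ℓ₂) → Interior₂Green (step H S A)
  interior₂-step S A interior ℓ₂-harmless b b≢ℓ₂ = stays-green S A (old₂ b) (interior b b≢ℓ₂) harmless
    where
    harmless : ∀ w → va (old₂ b) w ≡ true → HarmlessAt S A w
    harmless w bw with neighbour₂ b w b≢ℓ₂ bw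
    ... | c , refl with c ≟ ℓ₂
    ...   | yes refl = ℓ₂-harmless
    ...   | no c≢ℓ₂  = inj₂ (interior c c≢ℓ₂)

  ClearedFrom : ℕ → State H → Set
  ClearedFrom k S = (∀ b → GreenAt S (old₂ b)) × (∀ i → k ≤ toℕ i → GreenAt S (path i))

  -- The boundary of H₂ ∪ {p_i | k ≤ i} is p_{k-1}, or ℓ₁ when k = 0.
  clearedFrom-step : ∀ k S A → k ≤ s → ClearedFrom k S →
    (∀ i → suc (toℕ i) ≡ k → HarmlessAt S A (path i)) → (k ≡ 0 → HarmlessAt S A (old₁ ℓ₁)) →
    ClearedFrom k (step H S A)
  clearedFrom-step k S A k≤s (H₂-green , path-green) boundary ℓ₁-harmless = H₂-green′ , path-green′
    where
    up-to-boundary : ∀ j → k ≤ suc (toℕ j) → HarmlessAt S A (path j)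
    up-to-boundary j k≤j+1 with m≤n⇒m<n∨m≡n k≤j+1
    ... | inj₁ k≤j   = inj₂ (path-green j (s≤s⁻¹ k≤j))
    ... | inj₂ k≡j+1 = boundary j (sym k≡j+1)

    H₂-green′ : ∀ b → GreenAt (step H S A) (old₂ b)
    H₂-green′ b = stays-green S A (old₂ b) (H₂-green b) harmless
      where
      harmless : ∀ w → va (old₂ b) w ≡ true → HarmlessAt S A w
      harmless (old₁ _) ()
      harmless (old₂ c) _  = inj₂ (H₂-green c)
      harmless (path j) bj = up-to-boundary j (subst (k ≤_) (sym (eqN⇒≡ (∧-conicalʳ _ _ bj))) k≤s)
      harmless leaf     ()

    path-green′ : ∀ i → k ≤ toℕ i → GreenAt (step H S A) (path i)
    path-green′ i k≤i = stays-green S A (path i) (path-green i k≤i) harmless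
      where
      harmless : ∀ w → va (path i) w ≡ true → HarmlessAt S A w
      harmless (old₁ a) ia rewrite eqF⇒≡ {a = a} {ℓ₁} (∧-conicalˡ _ _ ia) =
        ℓ₁-harmless (n≤0⇒n≡0 (subst (k ≤_) (eqN⇒≡ (∧-conicalʳ _ _ ia)) k≤i))
      harmless (old₂ b) ib rewrite eqF⇒≡ {a = b} {ℓ₂} (∧-conicalˡ _ _ ib) = inj₂ (H₂-green ℓ₂)
      harmless (path j) ij = up-to-boundary j (≤-trans k≤i (path-adj⇒≤ i j ij))
      harmless leaf     ()

  sweep-step : ∀ k S A → k < s → ClearedFrom (suc k) S → (∀ i → toℕ i ≡ k → ImmunizedAt A (path i)) →
    ClearedFrom k (step H S A)
  sweep-step k S A k<s cleared immunized = proj₁ cleared′ , path-green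
    where
    cleared′ : ClearedFrom (suc k) (step H S A)
    cleared′ = clearedFrom-step (suc k) S A k<s cleared
      (λ i i+1≡k+1 → inj₁ (immunized i (suc-injective i+1≡k+1))) λ ()

    path-green : ∀ i → k ≤ toℕ i → GreenAt (step H S A) (path i)
    path-green i k≤i with m≤n⇒m<n∨m≡n k≤i
    ... | inj₁ k<i = proj₂ cleared′ i k<i
    ... | inj₂ k≡i = immunized-green S A (path i) (immunized i (sym k≡i))

  -- Distance from ℓ₁ through the path, with all of H₂ beyond ℓ₂ cut off at s + 1.
  reach₂ : Fin (n H₂) → ℕ
  reach₂ b with b ≟ ℓ₂
  ... | yes _ = s
  ... | no  _ = suc s

  reach : V → ℕ
  reach (old₁ _) = 0
  reach (old₂ b) = reach₂ b
  reach (path i) = toℕ i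
  reach leaf     = 0

  reach₂-ℓ₂ : reach₂ ℓ₂ ≡ s
  reach₂-ℓ₂ with ℓ₂ ≟ ℓ₂
  ... | yes _    = refl
  ... | no ℓ₂≢ℓ₂ = contradiction refl ℓ₂≢ℓ₂

  reach₂-interior : ∀ b → b ≢ ℓ₂ → reach₂ b ≡ suc s
  reach₂-interior b b≢ℓ₂ with b ≟ ℓ₂
  ... | yes b≡ℓ₂ = contradiction b≡ℓ₂ b≢ℓ₂
  ... | no  _    = refl

  s≤reach₂ : ∀ b → s ≤ reach₂ b
  s≤reach₂ b with b ≟ ℓ₂
  ... | yes _ = ≤-refl
  ... | no  _ = n≤1+n s

  reach₂≤1+s : ∀ b → reach₂ b ≤ suc s
  reach₂≤1+s b with b ≟ ℓ₂
  ... | yes _ = n≤1+n s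
  ... | no  _ = ≤-refl

  reach-adj : ∀ v w → va v w ≡ true → reach v ≤ suc (reach w)
  reach-adj (old₁ _) _        _  = z≤n
  reach-adj leaf     _        _  = z≤n
  reach-adj (old₂ _) (old₁ _) ()
  reach-adj (old₂ b) (old₂ c) _  = ≤-trans (reach₂≤1+s b) (s≤s (s≤reach₂ c))
  reach-adj (old₂ b) (path i) bi rewrite eqF⇒≡ {a = b} {ℓ₂} (∧-conicalˡ _ _ bi) | reach₂-ℓ₂ =
    ≤-reflexive (sym (eqN⇒≡ (∧-conicalʳ _ _ bi)))
  reach-adj (old₂ _) leaf     ()
  reach-adj (path i) (old₁ a) ia = subst (_≤ 1) (sym (eqN⇒≡ (∧-conicalʳ (eqF a ℓ₁) _ ia))) z≤n
  reach-adj (path i) (old₂ b) _  = ≤-trans (<⇒≤ (toℕ<n i)) (≤-trans (s≤reach₂ b) (n≤1+n _))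
  reach-adj (path i) (path j) ij = path-adj⇒≤ i j ij
  reach-adj (path _) leaf     ()

  ⟨_,_,_,_⟩ : Subset (n H₁) → Subset (n H₂) → Subset s → Bool → Subset (n H)
  ⟨ B₁ , B₂ , B₃ , b ⟩ = glueSubset B₁ B₂ B₃ b

  lookup-⟨⟩ : ∀ B₁ B₂ B₃ b (v : V) → lookup ⟨ B₁ , B₂ , B₃ , b ⟩ (ι v) ≡ lookupᵥ B₁ B₂ B₃ b v
  lookup-⟨⟩ = lookup-glueSubset

  inH₁ : Subset (n H₁) → Subset (n H)
  inH₁ B = ⟨ B , ⊥ , ⊥ , false ⟩

  inH₂ : Subset (n H₂) → Subset (n H)
  inH₂ B = ⟨ ⊥ , B , ⊥ , false ⟩

  immunizePath : ℕ → Subset (n H)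
  immunizePath k = ⟨ ⊥ , ⊥ , atIndex k , false ⟩

  immunizeℓ₂Path : Subset (n H)
  immunizeℓ₂Path = ⟨ ⊥ , ⁅ ℓ₂ ⁆ , atIndex s′ , false ⟩

  immunizeℓ₁Path : ℕ → Subset (n H)
  immunizeℓ₁Path k = ⟨ ⁅ ℓ₁ ⁆ , ⊥ , atIndex k , false ⟩

  immunizeℓ₁Leaf : Subset (n H)
  immunizeℓ₁Leaf = ⟨ ⁅ ℓ₁ ⁆ , ⊥ , ⊥ , true ⟩

  ℓ₁-immunized : ∀ B₂ B₃ b → ImmunizedAt ⟨ ⁅ ℓ₁ ⁆ , B₂ , B₃ , b ⟩ (old₁ ℓ₁)
  ℓ₁-immunized B₂ B₃ b = trans (lookup-⟨⟩ ⁅ ℓ₁ ⁆ B₂ B₃ b (old₁ ℓ₁)) (lookup-⁅x⁆ ℓ₁)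

  ℓ₂-immunized : ∀ B₁ B₃ b → ImmunizedAt ⟨ B₁ , ⁅ ℓ₂ ⁆ , B₃ , b ⟩ (old₂ ℓ₂)
  ℓ₂-immunized B₁ B₃ b = trans (lookup-⟨⟩ B₁ ⁅ ℓ₂ ⁆ B₃ b (old₂ ℓ₂)) (lookup-⁅x⁆ ℓ₂)

  path-immunized : ∀ B₁ B₂ b k i → toℕ i ≡ k → ImmunizedAt ⟨ B₁ , B₂ , atIndex k , b ⟩ (path i)
  path-immunized B₁ B₂ b k i refl = trans (lookup-⟨⟩ B₁ B₂ (atIndex (toℕ i)) b (path i)) (lookup-atIndex i)

  H₁-untouched : ∀ B₂ B₃ b a → NotImmunizedAt ⟨ ⊥ , B₂ , B₃ , b ⟩ (old₁ a)
  H₁-untouched B₂ B₃ b a = trans (lookup-⟨⟩ ⊥ B₂ B₃ b (old₁ a)) (lookup-⊥ a)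

  leaf-untouched : ∀ B₁ B₂ B₃ → NotImmunizedAt ⟨ B₁ , B₂ , B₃ , false ⟩ leaf
  leaf-untouched B₁ B₂ B₃ = lookup-⟨⟩ B₁ B₂ B₃ false leaf

  ι₁-neighbours : ∀ a → a ≢ ℓ₁ → ∀ y → adj H (ι₁ a) y ≡ true → ∃ λ c → y ≡ ι₁ c
  ι₁-neighbours a a≢ℓ₁ y ay with neighbour₁ a (classify y) a≢ℓ₁ (adj-ι⁻ (old₁ a) y ay)
  ... | c , eq = c , trans (sym (ι-classifyᴴ y)) (cong ι eq)

  ι₂-neighbours : ∀ b → b ≢ ℓ₂ → ∀ y → adj H (ι₂ b) y ≡ true → ∃ λ c → y ≡ ι₂ c
  ι₂-neighbours b b≢ℓ₂ y by with neighbour₂ b (classify y) b≢ℓ₂ (adj-ι⁻ (old₂ b) y by)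
  ... | c , eq = c , trans (sym (ι-classifyᴴ y)) (cong ι eq)

  module Embedded₁ = Embedding {H₁} {H} ι₁ inH₁ ℓ₁ (λ B a → lookup-⟨⟩ B ⊥ ⊥ false (old₁ a))
                               (λ a c → adj-ι (old₁ a) (old₁ c)) ι₁-neighbours
  module Embedded₂ = Embedding {H₂} {H} ι₂ inH₂ ℓ₂ (λ B b → lookup-⟨⟩ ⊥ B ⊥ false (old₂ b))
                               (λ b c → adj-ι (old₂ b) (old₂ c)) ι₂-neighbours

  H₁Infected : State H → Set
  H₁Infected S = ∀ a → Infected S (ι₁ a)

  BothInfected : State H → Set
  BothInfected S = H₁Infected S × (∀ b → Infected S (ι₂ b))

  Sweeping : ℕ → State H → Set
  Sweeping k S = k ≤ s′ × ClearedFrom (suc k) S × H₁Infected S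

  H₁Cleared : State H → Set
  H₁Cleared S = (∀ a → GreenAt S (old₁ a)) × Interior₂Green S

  GuardedSweeping : ℕ → State H → Set
  GuardedSweeping k S = k ≤ s′ × ClearedFrom k S × Interior₁Green S

  AllGreen : State H → Set
  AllGreen S = ∀ x → S x ≡ green

  triple-J₂ : ∀ J₂ → Clears H₂ J₂ → ImmunizedOnlyLast J₂ ℓ₂ → Triple H BothInfected (map inH₂ J₂) (Sweeping s′)
  triple-J₂ J₂ clears₂ last₂ S (H₁-infected , H₂-infected) =
    ≤-refl , (Embedded₂.run-embedded-clears S J₂ H₂-infected clears₂ last₂ , no-path) , H₁-infected′
    where
    no-path : ∀ i → s ≤ toℕ i → GreenAt (foldl (step H) S (map inH₂ J₂)) (path i)
    no-path i s≤i = contradiction (toℕ<n i) (≤⇒≯ s≤i)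
    H₁-infected′ : H₁Infected (foldl (step H) S (map inH₂ J₂))
    H₁-infected′ a = run-keeps-infected H S (map inH₂ J₂) (ι₁ a) (H₁-infected a)
      (map⁺ (All.universal (λ B → H₁-untouched B ⊥ false a) J₂))

  triple-sweep : ∀ k → Triple H (Sweeping (suc k)) [ immunizePath (suc k) ] (Sweeping k)
  triple-sweep k S (k<s′ , cleared , H₁-infected) =
    <⇒≤ k<s′ ,
    sweep-step (suc k) S A (s≤s k<s′) cleared (path-immunized ⊥ ⊥ false (suc k)) ,
    λ a → step-keeps-infected H S A (ι₁ a) (H₁-infected a) (H₁-untouched ⊥ (atIndex (suc k)) false a)
    where
    A = immunizePath (suc k)

  triple-J₁ : ∀ J₁ → length J₁ ≡ s → Clears H₁ J₁ → ImmunizedOnlyLast J₁ ℓ₁ →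
    Triple H (Sweeping 0) (map inH₁ J₁) H₁Cleared
  triple-J₁ J₁ len₁ clears₁ last₁ S (_ , (H₂-green , path-green) , H₁-infected) =
    Embedded₁.run-embedded-clears S J₁ H₁-infected clears₁ last₁ , interior₂
    where
    reachᴴ : Fin (n H) → ℕ
    reachᴴ = reach ∘ classify
    reachᴴ-adj : ∀ x y → adj H x y ≡ true → reachᴴ x ≤ suc (reachᴴ y)
    reachᴴ-adj x y = reach-adj (classify x) (classify y)
    far : GreenBeyond H reachᴴ 0 S
    far x 0<r = subst (λ y → S y ≡ green) (ι-classifyᴴ x) (farᵥ (classify x) 0<r)
      where
      farᵥ : ∀ v → 0 < reach v → GreenAt S v
      farᵥ (old₂ b) _   = H₂-green b
      farᵥ (path i) 0<i = path-green i 0<i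
    interior₂ : Interior₂Green (foldl (step H) S (map inH₁ J₁))
    interior₂ b b≢ℓ₂ = run-greenBeyond H reachᴴ reachᴴ-adj 0 S (map inH₁ J₁) far (ι₂ b) s<reach
      where
      s<reach : length (map inH₁ J₁) < reachᴴ (ι₂ b)
      s<reach rewrite length-map inH₁ J₁ | len₁ | classify-ι {n H₁} {n H₂} {s} (old₂ b)
                    | reach₂-interior b b≢ℓ₂ = ≤-refl

  triple-seal : Triple H H₁Cleared [ immunizeℓ₂Path ] (GuardedSweeping s′)
  triple-seal S (H₁-green , interior₂) =
    ≤-refl , (H₂-green , path-green) , interior₁-step S A (λ a _ → H₁-green a) (inj₂ (H₁-green ℓ₁))
    where
    A = immunizeℓ₂Path
    H₂-green : ∀ b → GreenAt (step H S A) (old₂ b)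
    H₂-green b with b ≟ ℓ₂
    ... | yes refl = immunized-green S A (old₂ ℓ₂) (ℓ₂-immunized ⊥ (atIndex s′) false)
    ... | no b≢ℓ₂  = interior₂-step S A interior₂ (inj₁ (ℓ₂-immunized ⊥ (atIndex s′) false)) b b≢ℓ₂
    path-green : ∀ i → s′ ≤ toℕ i → GreenAt (step H S A) (path i)
    path-green i s′≤i = immunized-green S A (path i)
      (path-immunized ⊥ ⁅ ℓ₂ ⁆ false s′ i (≤-antisym (s≤s⁻¹ (toℕ<n i)) s′≤i))

  triple-guardedSweep : ∀ k → Triple H (GuardedSweeping (suc k)) [ immunizeℓ₁Path k ] (GuardedSweeping k)
  triple-guardedSweep k S (k<s′ , cleared , interior₁) =
    <⇒≤ k<s′ ,
    sweep-step k S A (m<n⇒m<1+n k<s′) cleared (path-immunized ⁅ ℓ₁ ⁆ ⊥ false k) ,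
    interior₁-step S A interior₁ (inj₁ (ℓ₁-immunized ⊥ (atIndex k) false))
    where
    A = immunizeℓ₁Path k

  triple-finish : Triple H (GuardedSweeping 0) [ immunizeℓ₁Leaf ] AllGreen
  triple-finish S (_ , cleared , interior₁) x =
    subst (λ y → step H S A y ≡ green) (ι-classifyᴴ x) (green-at (classify x))
    where
    A = immunizeℓ₁Leaf
    ℓ₁-in : ImmunizedAt A (old₁ ℓ₁)
    ℓ₁-in = ℓ₁-immunized ⊥ ⊥ true
    cleared′ : ClearedFrom 0 (step H S A)
    cleared′ = clearedFrom-step 0 S A z≤n cleared (λ _ ()) (λ _ → inj₁ ℓ₁-in)
    green-at : ∀ v → GreenAt (step H S A) v
    green-at (old₁ a) with a ≟ ℓ₁
    ... | yes refl = immunized-green S A (old₁ ℓ₁) ℓ₁-in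
    ... | no a≢ℓ₁  = interior₁-step S A interior₁ (inj₁ ℓ₁-in) a a≢ℓ₁
    green-at (old₂ b) = proj₁ cleared′ b
    green-at (path i) = proj₂ cleared′ i z≤n
    green-at leaf     = immunized-green S A leaf (lookup-⟨⟩ ⁅ ℓ₁ ⁆ ⊥ ⊥ true leaf)

  sweep : Protocol (n H)
  sweep = applyDownFrom (immunizePath ∘ suc) s′

  guardedSweep : Protocol (n H)
  guardedSweep = applyDownFrom immunizeℓ₁Path s′

  gluedPrefix : Protocol (n H₁) → Protocol (n H₂) → Protocol (n H)
  gluedPrefix J₁ J₂ = map inH₂ J₂ ++ (sweep ++ (map inH₁ J₁ ++ (immunizeℓ₂Path ∷ guardedSweep)))

  gluedProtocol : Protocol (n H₁) → Protocol (n H₂) → Protocol (n H)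
  gluedProtocol J₁ J₂ = gluedPrefix J₁ J₂ ∷ʳ immunizeℓ₁Leaf

  gluedProtocol-clears : ∀ J₁ J₂ → length J₁ ≡ s → Clears H₁ J₁ → Clears H₂ J₂ →
    ImmunizedOnlyLast J₁ ℓ₁ → ImmunizedOnlyLast J₂ ℓ₂ → Clears H (gluedProtocol J₁ J₂)
  gluedProtocol-clears J₁ J₂ len₁ clears₁ clears₂ last₁ last₂ =
    triple-++ H {R = AllGreen} (gluedPrefix J₁ J₂) [ immunizeℓ₁Leaf ] prefix triple-finish
      (λ _ → red) ((λ _ → refl) , (λ _ → refl))
    where
    from-J₁ : Triple H (Sweeping 0) (map inH₁ J₁ ++ (immunizeℓ₂Path ∷ guardedSweep)) (GuardedSweeping 0)
    from-J₁ = triple-++ H {R = GuardedSweeping 0} (map inH₁ J₁) (immunizeℓ₂Path ∷ guardedSweep)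
                (triple-J₁ J₁ len₁ clears₁ last₁)
                (triple-++ H {R = GuardedSweeping 0} [ immunizeℓ₂Path ] guardedSweep triple-seal
                  (triple-applyDownFrom H GuardedSweeping immunizeℓ₁Path triple-guardedSweep s′))
    prefix : Triple H BothInfected (gluedPrefix J₁ J₂) (GuardedSweeping 0)
    prefix = triple-++ H {R = GuardedSweeping 0} (map inH₂ J₂) _ (triple-J₂ J₂ clears₂ last₂)
               (triple-++ H {R = GuardedSweeping 0} sweep _
                 (triple-applyDownFrom H Sweeping (immunizePath ∘ suc) triple-sweep s′) from-J₁)

  gluedPrefix-all : ∀ (P : Subset (n H) → Set) J₁ J₂ → All (P ∘ inH₁) J₁ → All (P ∘ inH₂) J₂ →
    (∀ k → P (immunizePath k)) → P immunizeℓ₂Path → (∀ k → P (immunizeℓ₁Path k)) → All P (gluedPrefix J₁ J₂)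
  gluedPrefix-all P J₁ J₂ on-J₁ on-J₂ on-sweep on-seal on-guarded =
    ++⁺ (map⁺ on-J₂) (++⁺ (applyDownFrom⁺₂ _ s′ (on-sweep ∘ suc))
                          (++⁺ (map⁺ on-J₁) (on-seal ∷ applyDownFrom⁺₂ _ s′ on-guarded)))

  ∣inH₁∣ : ∀ B → ∣ inH₁ B ∣ ≡ ∣ B ∣
  ∣inH₁∣ B rewrite ∣glueSubset∣ B (⊥ {n H₂}) (⊥ {s}) false | ∣⊥∣≡0 (n H₂) | ∣⊥∣≡0 s = +-identityʳ ∣ B ∣

  ∣inH₂∣ : ∀ B → ∣ inH₂ B ∣ ≡ ∣ B ∣
  ∣inH₂∣ B rewrite ∣glueSubset∣ (⊥ {n H₁}) B (⊥ {s}) false | ∣⊥∣≡0 (n H₁) | ∣⊥∣≡0 s = +-identityʳ ∣ B ∣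

  ∣immunizePath∣≤2 : ∀ k → ∣ immunizePath k ∣ ≤ 2
  ∣immunizePath∣≤2 k rewrite ∣glueSubset∣ (⊥ {n H₁}) (⊥ {n H₂}) (atIndex {s} k) false | ∣⊥∣≡0 (n H₁) | ∣⊥∣≡0 (n H₂)
                           | +-identityʳ ∣ atIndex {s} k ∣ = ≤-trans (∣atIndex∣≤1 {s} k) (n≤1+n 1)

  ∣immunizeℓ₂Path∣≤2 : ∣ immunizeℓ₂Path ∣ ≤ 2
  ∣immunizeℓ₂Path∣≤2 rewrite ∣glueSubset∣ (⊥ {n H₁}) ⁅ ℓ₂ ⁆ (atIndex {s} s′) false | ∣⊥∣≡0 (n H₁) | ∣⁅x⁆∣≡1 ℓ₂
                           | +-identityʳ ∣ atIndex {s} s′ ∣ = s≤s (∣atIndex∣≤1 {s} s′)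

  ∣immunizeℓ₁Path∣≤2 : ∀ k → ∣ immunizeℓ₁Path k ∣ ≤ 2
  ∣immunizeℓ₁Path∣≤2 k rewrite ∣glueSubset∣ ⁅ ℓ₁ ⁆ (⊥ {n H₂}) (atIndex {s} k) false | ∣⁅x⁆∣≡1 ℓ₁ | ∣⊥∣≡0 (n H₂)
                             | +-identityʳ ∣ atIndex {s} k ∣ = s≤s (∣atIndex∣≤1 {s} k)

  ∣immunizeℓ₁Leaf∣ : ∣ immunizeℓ₁Leaf ∣ ≡ 2
  ∣immunizeℓ₁Leaf∣ rewrite ∣glueSubset∣ ⁅ ℓ₁ ⁆ (⊥ {n H₂}) (⊥ {s}) true | ∣⁅x⁆∣≡1 ℓ₁ | ∣⊥∣≡0 (n H₂)
                         | ∣⊥∣≡0 s = refl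

  gluedProtocol-width : ∀ J₁ J₂ → width J₁ ≡ 2 → width J₂ ≡ 2 → width (gluedProtocol J₁ J₂) ≡ 2
  gluedProtocol-width J₁ J₂ width₁ width₂ = ≤-antisym
    (width-least (gluedProtocol J₁ J₂)
      (∷ʳ⁺ (gluedPrefix-all (λ A → ∣ A ∣ ≤ 2) J₁ J₂ (bounded inH₁ ∣inH₁∣ J₁ width₁) (bounded inH₂ ∣inH₂∣ J₂ width₂)
                            ∣immunizePath∣≤2 ∣immunizeℓ₂Path∣≤2 ∣immunizeℓ₁Path∣≤2)
           (≤-reflexive ∣immunizeℓ₁Leaf∣)))
    (subst (_≤ width (gluedProtocol J₁ J₂)) ∣immunizeℓ₁Leaf∣
      (All.lookup (width-bounds (gluedProtocol J₁ J₂)) (∈-insert (gluedPrefix J₁ J₂))))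
    where
    bounded : ∀ {m} (f : Subset m → Subset (n H)) → (∀ B → ∣ f B ∣ ≡ ∣ B ∣) → ∀ J → width J ≡ 2 →
      All (λ B → ∣ f B ∣ ≤ 2) J
    bounded f ∣f∣ J width≡2 =
      All.map (λ {B} bound → subst (_≤ 2) (sym (∣f∣ B)) (subst (∣ B ∣ ≤_) width≡2 bound)) (width-bounds J)

  gluedProtocol-length : ∀ J₁ J₂ → length J₁ ≡ s → length (gluedProtocol J₁ J₂) ≡ length J₂ + 3 * s
  gluedProtocol-length J₁ J₂ len₁ = begin
    length (gluedPrefix J₁ J₂ ∷ʳ immunizeℓ₁Leaf)  ≡⟨ length-++ (gluedPrefix J₁ J₂) ⟩
    length (gluedPrefix J₁ J₂) + 1                ≡⟨ cong (_+ 1) prefix-length ⟩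
    length J₂ + (s′ + (s + s)) + 1                ≡⟨ arithmetic (length J₂) s′ ⟩
    length J₂ + 3 * s                             ∎
    where
    open ≡-Reasoning
    from-J₁ : Protocol (n H)
    from-J₁ = map inH₁ J₁ ++ (immunizeℓ₂Path ∷ guardedSweep)
    prefix-length : length (gluedPrefix J₁ J₂) ≡ length J₂ + (s′ + (s + s))
    prefix-length rewrite length-++ (map inH₂ J₂) {sweep ++ from-J₁} | length-++ sweep {from-J₁}
                        | length-++ (map inH₁ J₁) {immunizeℓ₂Path ∷ guardedSweep}
                        | length-map inH₂ J₂ | length-map inH₁ J₁ | len₁
                        | length-applyDownFrom (immunizePath ∘ suc) s′ | length-applyDownFrom immunizeℓ₁Path s′ = refl
    arithmetic : ∀ l k → l + (k + (suc k + suc k)) + 1 ≡ l + 3 * suc k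
    arithmetic = solve-∀

  gluedProtocol-leaf : ∀ J₁ J₂ → ImmunizedOnlyLast (gluedProtocol J₁ J₂) (newLeaf H₁ H₂ s)
  gluedProtocol-leaf J₁ J₂ =
    gluedPrefix J₁ J₂ , immunizeℓ₁Leaf , refl , lookup-⟨⟩ ⁅ ℓ₁ ⁆ ⊥ ⊥ true leaf ,
    gluedPrefix-all (λ A → NotImmunizedAt A leaf) J₁ J₂
      (All.universal (λ B → leaf-untouched B ⊥ ⊥) J₁) (All.universal (λ B → leaf-untouched ⊥ B ⊥) J₂)
      (λ k → leaf-untouched ⊥ ⊥ (atIndex k)) (leaf-untouched ⊥ ⁅ ℓ₂ ⁆ (atIndex s′))
      (λ k → leaf-untouched ⁅ ℓ₁ ⁆ ⊥ (atIndex k))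

immunizedOnlyLast-nonempty : ∀ {m} {J : Protocol m} {ℓ} → ImmunizedOnlyLast J ℓ → length J ≢ 0
immunizedOnlyLast-nonempty ([]    , _ , refl , _) ()
immunizedOnlyLast-nonempty (_ ∷ _ , _ , refl , _) ()

theorem5p2 : (H₁ H₂ : Graph) → IsSimple H₁ → IsSimple H₂ →
    (ℓ₁ : Fin (n H₁)) → (ℓ₂ : Fin (n H₂)) → IsLeaf H₁ ℓ₁ → IsLeaf H₂ ℓ₂ →
    (J₁ : Protocol (n H₁)) → (J₂ : Protocol (n H₂)) →
    width J₁ ≡ 2 → width J₂ ≡ 2 → Clears H₁ J₁ → Clears H₂ J₂ →
    ImmunizedOnlyLast J₁ ℓ₁ → ImmunizedOnlyLast J₂ ℓ₂ →
    Σ (Protocol (n (glue H₁ H₂ ℓ₁ ℓ₂ (length J₁)))) λ J →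
      (width J ≡ 2) × Clears (glue H₁ H₂ ℓ₁ ℓ₂ (length J₁)) J ×
      (length J ≤ length J₂ + 3 * length J₁) ×
      ImmunizedOnlyLast J (newLeaf H₁ H₂ (length J₁))
theorem5p2 H₁ H₂ _ _ ℓ₁ ℓ₂ _ _ J₁ J₂ width₁ width₂ clears₁ clears₂ last₁ last₂ with length J₁ in len₁
... | zero   = contradiction len₁ (immunizedOnlyLast-nonempty last₁)
... | suc s′ =
  gluedProtocol J₁ J₂ ,
  gluedProtocol-width J₁ J₂ width₁ width₂ ,
  gluedProtocol-clears J₁ J₂ len₁ clears₁ clears₂ last₁ last₂ ,
  ≤-reflexive (gluedProtocol-length J₁ J₂ len₁) ,
  gluedProtocol-leaf J₁ J₂
  where open Glued H₁ H₂ ℓ₁ ℓ₂ s′
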